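{- Let $G=(V,E)$ be an undirected graph with vertex set $V=\{v_1,\ldots,v_n\}$ and $m=|E|$ edges. Let $D$ be an orientation of $G$ in which the out-degree of $v_i$ is $d_i$ for every $1\le i\le n$, and let $f:\{1,\ldots,n\}\to\mathbb{N}$ be given by $f(i)=d_i+1$. For every $1\le i\le n$ and every $1\le j\le d_i$ let $u^i_j$ be an arbitrary real number. Then $G$ is $f$-AT if and only if $$\sum_{A\subseteq E}(-1)^{|A|}\prod_{i=1}^n\prod_{j=1}^{d_i}\Big(\big(d^+_A(v_i)-d^-_A(v_i)\big)-u^i_j\Big)\neq 0,$$ where the sum ranges over all subsets $A$ of the arcs of $D$.
   Context: Identify $v_i$ with the index $i$. The graph polynomial of $G$ is $P_G(x_1,\ldots,x_n)=\prod_{i<j,\ (i,j)\in E}(x_i-x_j)$ (one factor per edge; $P_G\equiv 1$ if $E=\emptyset$). For $f:V\to\mathbb{N}^+$, $G$ is called Alon-Tarsi $f$-choosable ($f$-AT) if the expansion of $P_G$ contains a monomial $c\prod_{i=1}^n x_i^{t_i}$ with real coefficient $c\neq 0$ and $t_i\le f(i)-1$ for all $i$. For a set $A$ of arcs of $D$ and a vertex $v$, $d^+_A(v)$ is the number of arcs of $A$ with tail $v$ and $d^-_A(v)$ is the number of arcs of $A$ with head $v$. -}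

module Defs where

open import Level using (Level; _⊔_)
open import Data.Nat as ℕ using (ℕ; zero; suc)
open import Data.Integer as ℤ using (ℤ)
open import Data.Bool using (Bool; true; false; if_then_else_)
open import Data.Fin as Fin using (Fin)
open import Data.Fin.Properties using () renaming (_≟_ to _≟ᶠ_)
open import Data.Vec as Vec using (Vec; []; _∷_)
open import Data.Vec.Properties using (≡-dec)
open import Data.List as List using (List; []; _∷_; _++_)
open import Data.Product using (_×_; _,_; proj₁; proj₂; ∃)
open import Function.Definitions using (Injective)
open import Relation.Binary.PropositionalEquality using (_≡_)
open import Relation.Nullary using (¬_; yes; no)
open import Algebra.Bundles using (CommutativeRing)

record Graph (n m : ℕ) : Set where
  field
    edge      : Fin m → Fin n × Fin n
    ordered   : ∀ e → proj₁ (edge e) Fin.< proj₂ (edge e)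
    injective : Injective _≡_ _≡_ edge
open Graph public

-- An orientation of G: for each edge, true = arc from the smaller
-- endpoint to the larger one, false = the reverse.
Orientation : ∀ {n m} → Graph n m → Set
Orientation {m = m} G = Fin m → Bool

tail : ∀ {n m} (G : Graph n m) → Orientation G → Fin m → Fin n
tail G D e = if D e then proj₁ (edge G e) else proj₂ (edge G e)

head : ∀ {n m} (G : Graph n m) → Orientation G → Fin m → Fin n
head G D e = if D e then proj₂ (edge G e) else proj₁ (edge G e)

countFin : ∀ {m} → (Fin m → Bool) → ℕ
countFin {zero}  p = 0
countFin {suc m} p = (if p Fin.zero then 1 else 0) ℕ.+ countFin (λ e → p (Fin.suc e))

isYes : ∀ {n} → Fin n → Fin n → Bool
isYes i j with i ≟ᶠ j
... | yes _ = true
... | no  _ = false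

_∧_ : Bool → Bool → Bool
true  ∧ b = b
false ∧ _ = false

-- A set of arcs of D: a subset of the arc labels Fin m.
ArcSet : ℕ → Set
ArcSet m = Vec Bool m

allSubsets : ∀ m → List (ArcSet m)
allSubsets zero    = [] ∷ []
allSubsets (suc m) = List.map (true ∷_) (allSubsets m) ++ List.map (false ∷_) (allSubsets m)

card : ∀ {m} → ArcSet m → ℕ
card A = countFin (λ e → Vec.lookup A e)

outdeg : ∀ {n m} (G : Graph n m) → Orientation G → Fin n → ℕ
outdeg G D v = countFin (λ e → isYes (tail G D e) v)

outdegA : ∀ {n m} (G : Graph n m) → Orientation G → ArcSet m → Fin n → ℕ
outdegA G D A v = countFin (λ e → Vec.lookup A e ∧ isYes (tail G D e) v)

indegA : ∀ {n m} (G : Graph n m) → Orientation G → ArcSet m → Fin n → ℕ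
indegA G D A v = countFin (λ e → Vec.lookup A e ∧ isYes (head G D e) v)

-- Multivariate polynomials over ℤ in variables x_0..x_{n-1}, represented
-- as formal (unnormalised) sums of terms  c · x^α.

Monomial : ℕ → Set
Monomial n = Vec ℕ n

Poly : ℕ → Set
Poly n = List (ℤ × Monomial n)

constP : ∀ {n} → ℤ → Poly n
constP c = (c , Vec.replicate _ 0) ∷ []

varP : ∀ {n} → Fin n → Poly n
varP i = (ℤ.+ 1 , Vec.tabulate (λ k → if isYes k i then 1 else 0)) ∷ []

_+P_ : ∀ {n} → Poly n → Poly n → Poly n
p +P q = p ++ q

negP : ∀ {n} → Poly n → Poly n
negP = List.map (λ t → ℤ.- proj₁ t , proj₂ t)

_-P_ : ∀ {n} → Poly n → Poly n → Poly n
p -P q = p +P negP q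

_*P_ : ∀ {n} → Poly n → Poly n → Poly n
p *P q = List.concatMap (λ s → List.map (λ t → proj₁ s ℤ.* proj₁ t , Vec.zipWith ℕ._+_ (proj₂ s) (proj₂ t)) q) p

coeff : ∀ {n} → Poly n → Monomial n → ℤ
coeff [] t = ℤ.+ 0
coeff ((c , α) ∷ p) t with ≡-dec ℕ._≟_ α t
... | yes _ = c ℤ.+ coeff p t
... | no  _ = coeff p t

prodFinP : ∀ {n m} → (Fin m → Poly n) → Poly n
prodFinP {m = zero}  g = constP (ℤ.+ 1)
prodFinP {m = suc m} g = g Fin.zero *P prodFinP (λ e → g (Fin.suc e))

graphPoly : ∀ {n m} → Graph n m → Poly n
graphPoly G = prodFinP (λ e → varP (proj₁ (edge G e)) -P varP (proj₂ (edge G e)))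

AT : ∀ {n m} → Graph n m → (Fin n → ℕ) → Set
AT {n} G f = ∃ λ (t : Monomial n) →
  ¬ (coeff (graphPoly G) t ≡ ℤ.+ 0) × (∀ i → Vec.lookup t i ℕ.≤ f i ℕ.∸ 1)

module RingOps {c ℓ : Level} (R : CommutativeRing c ℓ) where
  open CommutativeRing R

  fromℕ : ℕ → Carrier
  fromℕ zero    = 0#
  fromℕ (suc k) = 1# + fromℕ k

  pow : Carrier → ℕ → Carrier
  pow x zero    = 1#
  pow x (suc k) = x * pow x k

  sumL : List Carrier → Carrier
  sumL = List.foldr _+_ 0#

  prodFin : ∀ {k} → (Fin k → Carrier) → Carrier
  prodFin {zero}  g = 1#
  prodFin {suc k} g = g Fin.zero * prodFin (λ j → g (Fin.suc j))

  CharZero : Set ℓ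
  CharZero = ∀ k → ¬ (fromℕ (suc k) ≈ 0#)

  ATSum : ∀ {n m} (G : Graph n m) (D : Orientation G) →
          ((i : Fin n) → Fin (outdeg G D i) → Carrier) → Carrier
  ATSum {n} {m} G D u = sumL (List.map term (allSubsets m))
    where
    term : ArcSet m → Carrier
    term A = pow (- 1#) (card A) *
      prodFin (λ (i : Fin n) → prodFin (λ (j : Fin (outdeg G D i)) →
        (fromℕ (outdegA G D A i) - fromℕ (indegA G D A i)) - u i j))

module Submission where

-- For a list L of factors (i , w) put S(L) = Σ_{A ⊆ D} (-1)^|A| ∏_{(i,w) ∈ L} (d⁺_A(i) − d⁻_A(i) − w).
-- Splitting the subsets by whether they contain the first arc T → H, and telescoping the
-- difference of the two resulting products, shows that as long as |L| ≤ m, S(L) satisfies in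
-- the multiplicity vector t of L the recursion of K(t) = (-1)^m t! [x^t] ∏_{arcs} (x_T − x_H);
-- so S(L) = K(t), whatever the constants w. For the theorem's factors t is the out-degree
-- vector d, and reversing arcs only changes the sign, so the sum is ±d! times the coefficient
-- of x^d in P_G. As P_G is homogeneous of degree m = Σ dᵢ, x^d is the only monomial allowed
-- by f, and in characteristic 0 the sum vanishes exactly when its coefficient does.

open import Defs
open import Level using (Level)
open import Algebra.Bundles using (CommutativeRing)
open import Data.Bool using (Bool; true; false; if_then_else_)
open import Data.Fin as Fin using (Fin)
open import Data.Fin.Properties using () renaming (_≟_ to _≟ᶠ_)
open import Data.Integer as ℤ using (ℤ; -1ℤ)
import Data.Integer.Properties as ℤ
open import Data.Integer.Tactic.RingSolver using (solve-∀)
open import Data.List as List using (List; []; _∷_; _++_)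
import Data.List.Properties as List
open import Data.List.Relation.Unary.All as All using (All; []; _∷_)
import Data.List.Relation.Unary.All.Properties as All
open import Data.Nat as ℕ using (ℕ; zero; suc; _∸_; _≤_; z≤n; NonZero; _!)
import Data.Nat.Properties as ℕ
open import Data.Product using (_×_; _,_; proj₁; proj₂; ∃)
open import Data.Sum using (_⊎_; inj₁; inj₂)
open import Data.Unit using (tt)
open import Data.Vec as Vec using (Vec; []; _∷_; lookup; tabulate; zipWith; replicate)
import Data.Vec.Properties as Vec
open import Function using (_∘_)
open import Function.Bundles using (_⇔_; mk⇔; Equivalence)
open import Function.Construct.Symmetry using (⇔-sym)
import Function.Related.Propositional as Related
open import Function.Related.TypeIsomorphisms using (¬-cong-⇔)
open import Relation.Binary.PropositionalEquality as ≡ using (_≡_; _≢_)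
open import Relation.Nullary using (¬_; yes; no)
open import Relation.Nullary.Negation using (contradiction)

module Exponents where
  open ≡
  open import Algebra.Properties.CommutativeSemigroup ℕ.*-commutativeSemigroup using (x∙yz≈y∙xz)
  open ≡-Reasoning

  private variable
    n : ℕ
    a : Level
    A : Set a

  indicator : Bool → ℕ
  indicator b = if b then 1 else 0

  isYes-refl : (i : Fin n) → isYes i i ≡ true
  isYes-refl i with i ≟ᶠ i
  ... | yes _   = refl
  ... | no i≢i = contradiction refl i≢i

  isYes-≢ : {i j : Fin n} → i ≢ j → isYes i j ≡ false
  isYes-≢ {i = i} {j} i≢j with i ≟ᶠ j
  ... | yes i≡j = contradiction i≡j i≢j
  ... | no _    = refl

  isYes-sym : (i j : Fin n) → isYes i j ≡ isYes j i
  isYes-sym i j with i ≟ᶠ j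
  ... | yes refl = sym (isYes-refl i)
  ... | no i≢j   = sym (isYes-≢ (i≢j ∘ sym))

  isYes-suc : (i j : Fin n) → isYes (Fin.suc i) (Fin.suc j) ≡ isYes i j
  isYes-suc i j with i ≟ᶠ j
  ... | yes _ = refl
  ... | no _  = refl

  unitVec : Fin n → Vec ℕ n
  unitVec i = tabulate (λ k → indicator (isYes k i))

  inc : Fin n → Vec ℕ n → Vec ℕ n
  inc i v = zipWith ℕ._+_ (unitVec i) v

  dec : Fin n → Vec ℕ n → Vec ℕ n
  dec i v = zipWith _∸_ v (unitVec i)

  unitVec-suc : (i : Fin n) → unitVec (Fin.suc i) ≡ 0 ∷ unitVec i
  unitVec-suc i = cong (0 ∷_) (Vec.tabulate-cong (λ k → cong indicator (isYes-suc k i)))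

  inc-zero : ∀ x (xs : Vec ℕ n) → inc Fin.zero (x ∷ xs) ≡ suc x ∷ xs
  inc-zero x xs = cong (suc x ∷_) (0+ xs)
    where
    0+ : ∀ {n} (xs : Vec ℕ n) → zipWith ℕ._+_ (tabulate (λ _ → 0)) xs ≡ xs
    0+ []       = refl
    0+ (y ∷ ys) = cong (y ∷_) (0+ ys)

  inc-suc : ∀ (i : Fin n) x xs → inc (Fin.suc i) (x ∷ xs) ≡ x ∷ inc i xs
  inc-suc i x xs = cong (λ u → zipWith ℕ._+_ u (x ∷ xs)) (unitVec-suc i)

  dec-zero : ∀ x (xs : Vec ℕ n) → dec Fin.zero (x ∷ xs) ≡ (x ∸ 1) ∷ xs
  dec-zero x xs = cong ((x ∸ 1) ∷_) (∸0 xs)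
    where
    ∸0 : ∀ {n} (xs : Vec ℕ n) → zipWith _∸_ xs (tabulate (λ _ → 0)) ≡ xs
    ∸0 []       = refl
    ∸0 (y ∷ ys) = cong (y ∷_) (∸0 ys)

  dec-suc : ∀ (i : Fin n) x xs → dec (Fin.suc i) (x ∷ xs) ≡ x ∷ dec i xs
  dec-suc i x xs = cong (zipWith _∸_ (x ∷ xs)) (unitVec-suc i)

  dec-inc : (i : Fin n) (v : Vec ℕ n) → dec i (inc i v) ≡ v
  dec-inc Fin.zero    (x ∷ xs) = trans (cong (dec Fin.zero) (inc-zero x xs)) (dec-zero (suc x) xs)
  dec-inc (Fin.suc i) (x ∷ xs) = begin
    dec (Fin.suc i) (inc (Fin.suc i) (x ∷ xs)) ≡⟨ cong (dec (Fin.suc i)) (inc-suc i x xs) ⟩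
    dec (Fin.suc i) (x ∷ inc i xs)             ≡⟨ dec-suc i x (inc i xs) ⟩
    x ∷ dec i (inc i xs)                       ≡⟨ cong (x ∷_) (dec-inc i xs) ⟩
    x ∷ xs                                     ∎

  inc-dec : (i : Fin n) (v : Vec ℕ n) {k : ℕ} → lookup v i ≡ suc k → inc i (dec i v) ≡ v
  inc-dec Fin.zero    (x ∷ xs) refl = trans (cong (inc Fin.zero) (dec-zero x xs)) (inc-zero _ xs)
  inc-dec (Fin.suc i) (x ∷ xs) vᵢ≡1+k = begin
    inc (Fin.suc i) (dec (Fin.suc i) (x ∷ xs)) ≡⟨ cong (inc (Fin.suc i)) (dec-suc i x xs) ⟩
    inc (Fin.suc i) (x ∷ dec i xs)             ≡⟨ inc-suc i x (dec i xs) ⟩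
    x ∷ inc i (dec i xs)                       ≡⟨ cong (x ∷_) (inc-dec i xs vᵢ≡1+k) ⟩
    x ∷ xs                                     ∎

  lookup-inc : (i k : Fin n) (v : Vec ℕ n) → lookup (inc i v) k ≡ indicator (isYes k i) ℕ.+ lookup v k
  lookup-inc i k v = trans (Vec.lookup-zipWith ℕ._+_ k (unitVec i) v)
                           (cong (ℕ._+ lookup v k) (Vec.lookup∘tabulate _ k))

  lookup-inc-self : (i : Fin n) (v : Vec ℕ n) → lookup (inc i v) i ≡ suc (lookup v i)
  lookup-inc-self i v = trans (lookup-inc i i v) (cong (λ b → indicator b ℕ.+ lookup v i) (isYes-refl i))

  inc-comm : (i j : Fin n) (v : Vec ℕ n) → inc i (inc j v) ≡ inc j (inc i v)
  inc-comm i j v = begin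
    zipWith ℕ._+_ (unitVec i) (zipWith ℕ._+_ (unitVec j) v) ≡⟨ Vec.zipWith-assoc ℕ.+-assoc (unitVec i) (unitVec j) v ⟨
    zipWith ℕ._+_ (zipWith ℕ._+_ (unitVec i) (unitVec j)) v ≡⟨ cong (λ w → zipWith ℕ._+_ w v) (Vec.zipWith-comm ℕ.+-comm (unitVec i) (unitVec j)) ⟩
    zipWith ℕ._+_ (zipWith ℕ._+_ (unitVec j) (unitVec i)) v ≡⟨ Vec.zipWith-assoc ℕ.+-assoc (unitVec j) (unitVec i) v ⟩
    zipWith ℕ._+_ (unitVec j) (zipWith ℕ._+_ (unitVec i) v) ∎

  sum-inc : (i : Fin n) (v : Vec ℕ n) → Vec.sum (inc i v) ≡ suc (Vec.sum v)
  sum-inc Fin.zero    (x ∷ xs) = cong Vec.sum (inc-zero x xs)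
  sum-inc (Fin.suc i) (x ∷ xs) = begin
    Vec.sum (inc (Fin.suc i) (x ∷ xs)) ≡⟨ cong Vec.sum (inc-suc i x xs) ⟩
    x ℕ.+ Vec.sum (inc i xs)           ≡⟨ cong (x ℕ.+_) (sum-inc i xs) ⟩
    x ℕ.+ suc (Vec.sum xs)             ≡⟨ ℕ.+-suc x (Vec.sum xs) ⟩
    suc (Vec.sum (x ∷ xs))             ∎

  sum-replicate-0 : ∀ n → Vec.sum (replicate n 0) ≡ 0
  sum-replicate-0 zero    = refl
  sum-replicate-0 (suc n) = sum-replicate-0 n

  multiFactorial : Vec ℕ n → ℕ
  multiFactorial []       = 1
  multiFactorial (x ∷ xs) = x ! ℕ.* multiFactorial xs

  multiFactorial-replicate-0 : ∀ n → multiFactorial (replicate n 0) ≡ 1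
  multiFactorial-replicate-0 zero    = refl
  multiFactorial-replicate-0 (suc n) = trans (ℕ.+-identityʳ _) (multiFactorial-replicate-0 n)

  multiFactorial-dec : (i : Fin n) (t : Vec ℕ n) {k : ℕ} → lookup t i ≡ suc k →
                       multiFactorial t ≡ suc k ℕ.* multiFactorial (dec i t)
  multiFactorial-dec Fin.zero (x ∷ xs) {k} refl = begin
    suc k ! ℕ.* multiFactorial xs              ≡⟨ ℕ.*-assoc (suc k) (k !) (multiFactorial xs) ⟩
    suc k ℕ.* (k ! ℕ.* multiFactorial xs)      ≡⟨ cong (λ w → suc k ℕ.* multiFactorial w) (dec-zero (suc k) xs) ⟨
    suc k ℕ.* multiFactorial (dec Fin.zero (suc k ∷ xs)) ∎
  multiFactorial-dec (Fin.suc i) (x ∷ xs) {k} tᵢ≡1+k = begin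
    x ! ℕ.* multiFactorial xs                        ≡⟨ cong (x ! ℕ.*_) (multiFactorial-dec i xs tᵢ≡1+k) ⟩
    x ! ℕ.* (suc k ℕ.* multiFactorial (dec i xs))    ≡⟨ x∙yz≈y∙xz (x !) (suc k) _ ⟩
    suc k ℕ.* (x ! ℕ.* multiFactorial (dec i xs))    ≡⟨ cong (λ w → suc k ℕ.* multiFactorial w) (dec-suc i x xs) ⟨
    suc k ℕ.* multiFactorial (dec (Fin.suc i) (x ∷ xs)) ∎

  multiFactorial-nonZero : (t : Vec ℕ n) → NonZero (multiFactorial t)
  multiFactorial-nonZero []       = _
  multiFactorial-nonZero (x ∷ xs) = ℕ.m*n≢0 (x !) _ {{x ℕ.!≢0}} {{multiFactorial-nonZero xs}}

  pointwise-≤∧sum-≡⇒≡ : (t d : Vec ℕ n) → (∀ i → lookup t i ≤ lookup d i) → Vec.sum t ≡ Vec.sum d → t ≡ d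
  pointwise-≤∧sum-≡⇒≡ []       []       _   _  = refl
  pointwise-≤∧sum-≡⇒≡ (x ∷ xs) (y ∷ ys) t≤d eq =
    cong₂ _∷_ x≡y (pointwise-≤∧sum-≡⇒≡ xs ys (t≤d ∘ Fin.suc) (ℕ.+-cancelˡ-≡ x _ _ (trans eq (cong (ℕ._+ Vec.sum ys) (sym x≡y)))))
    where
    sum-mono : ∀ {n} (t d : Vec ℕ n) → (∀ i → lookup t i ≤ lookup d i) → Vec.sum t ≤ Vec.sum d
    sum-mono []       []       _   = z≤n
    sum-mono (a ∷ as) (b ∷ bs) a≤b = ℕ.+-mono-≤ (a≤b Fin.zero) (sum-mono as bs (a≤b ∘ Fin.suc))
    x≡y : x ≡ y
    x≡y = ℕ.≤-antisym (t≤d Fin.zero)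
            (ℕ.+-cancelʳ-≤ (Vec.sum ys) y x (subst (_≤ x ℕ.+ Vec.sum ys) eq (ℕ.+-monoʳ-≤ x (sum-mono xs ys (t≤d ∘ Fin.suc)))))

  multiplicities : List (Fin n × A) → Vec ℕ n
  multiplicities []            = replicate _ 0
  multiplicities ((i , _) ∷ L) = inc i (multiplicities L)

  length≡sum-multiplicities : (L : List (Fin n × A)) → List.length L ≡ Vec.sum (multiplicities L)
  length≡sum-multiplicities {n = n} []   = sym (sum-replicate-0 n)
  length≡sum-multiplicities ((i , _) ∷ L) =
    trans (cong suc (length≡sum-multiplicities L)) (sym (sum-inc i (multiplicities L)))

  lookup-multiplicities-++ : (L₁ L₂ : List (Fin n × A)) (k : Fin n) →
    lookup (multiplicities (L₁ ++ L₂)) k ≡ lookup (multiplicities L₁) k ℕ.+ lookup (multiplicities L₂) k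
  lookup-multiplicities-++ []             L₂ k = cong (ℕ._+ lookup (multiplicities L₂) k) (sym (Vec.lookup-replicate k 0))
  lookup-multiplicities-++ ((i , _) ∷ L₁) L₂ k = begin
    lookup (inc i (multiplicities (L₁ ++ L₂))) k
      ≡⟨ lookup-inc i k _ ⟩
    indicator (isYes k i) ℕ.+ lookup (multiplicities (L₁ ++ L₂)) k
      ≡⟨ cong (indicator (isYes k i) ℕ.+_) (lookup-multiplicities-++ L₁ L₂ k) ⟩
    indicator (isYes k i) ℕ.+ (lookup (multiplicities L₁) k ℕ.+ lookup (multiplicities L₂) k)
      ≡⟨ ℕ.+-assoc (indicator (isYes k i)) _ _ ⟨
    (indicator (isYes k i) ℕ.+ lookup (multiplicities L₁) k) ℕ.+ lookup (multiplicities L₂) k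
      ≡⟨ cong (ℕ._+ lookup (multiplicities L₂) k) (lookup-inc i k (multiplicities L₁)) ⟨
    lookup (inc i (multiplicities L₁)) k ℕ.+ lookup (multiplicities L₂) k ∎

  lookup-multiplicities-tabulate : ∀ {m} (h : Fin m → Fin n) (f : Fin m → A) (k : Fin n) →
    lookup (multiplicities (List.tabulate (λ e → (h e , f e)))) k ≡ countFin (λ e → isYes (h e) k)
  lookup-multiplicities-tabulate {m = zero}  h f k = Vec.lookup-replicate k 0
  lookup-multiplicities-tabulate {m = suc m} h f k =
    trans (lookup-inc (h Fin.zero) k _)
          (cong₂ ℕ._+_ (cong indicator (isYes-sym k (h Fin.zero))) (lookup-multiplicities-tabulate (h ∘ Fin.suc) (f ∘ Fin.suc) k))

  countFin-const : ∀ m (b : Bool) → countFin {m} (λ _ → b) ≡ indicator b ℕ.* m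
  countFin-const zero    b = sym (ℕ.*-zeroʳ (indicator b))
  countFin-const (suc m) b = trans (cong (indicator b ℕ.+_) (countFin-const m b)) (sym (ℕ.*-suc (indicator b) m))

  lookup-multiplicities-concat : ∀ {n′} (h : Fin n′ → Fin n) (d : Fin n′ → ℕ) (f : ∀ i → Fin (d i) → A) (k : Fin n) →
    lookup (multiplicities (List.concat (List.tabulate (λ i → List.tabulate (λ j → (h i , f i j)))))) k ≡
    Vec.sum (tabulate (λ i → indicator (isYes (h i) k) ℕ.* d i))
  lookup-multiplicities-concat {n′ = zero}   h d f k = Vec.lookup-replicate k 0
  lookup-multiplicities-concat {n′ = suc n′} h d f k =
    trans (lookup-multiplicities-++ (List.tabulate (λ j → (h Fin.zero , f Fin.zero j))) _ k)
          (cong₂ ℕ._+_ (trans (lookup-multiplicities-tabulate (λ _ → h Fin.zero) (f Fin.zero) k)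
                              (countFin-const (d Fin.zero) (isYes (h Fin.zero) k)))
                       (lookup-multiplicities-concat (h ∘ Fin.suc) (d ∘ Fin.suc) (f ∘ Fin.suc) k))

  sum-indicator* : (k : Fin n) (g : Fin n → ℕ) → Vec.sum (tabulate (λ i → indicator (isYes i k) ℕ.* g i)) ≡ g k
  sum-indicator* {suc n} Fin.zero g =
    trans (cong₂ ℕ._+_ (ℕ.+-identityʳ (g Fin.zero)) (sum-zeros n)) (ℕ.+-identityʳ (g Fin.zero))
    where
    sum-zeros : ∀ n → Vec.sum (tabulate {n = n} (λ _ → 0)) ≡ 0
    sum-zeros zero    = refl
    sum-zeros (suc n) = sum-zeros n
  sum-indicator* {suc n} (Fin.suc k) g = begin
    Vec.sum (tabulate (λ i → indicator (isYes (Fin.suc i) (Fin.suc k)) ℕ.* g (Fin.suc i)))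
      ≡⟨ cong Vec.sum (Vec.tabulate-cong (λ i → cong (λ b → indicator b ℕ.* g (Fin.suc i)) (isYes-suc i k))) ⟩
    Vec.sum (tabulate (λ i → indicator (isYes i k) ℕ.* g (Fin.suc i)))
      ≡⟨ sum-indicator* k (g ∘ Fin.suc) ⟩
    g (Fin.suc k) ∎

  flatten : (d : Fin n → ℕ) → ((i : Fin n) → Fin (d i) → A) → List (Fin n × A)
  flatten d f = List.concat (List.tabulate (λ i → List.tabulate (λ j → (i , f i j))))

  multiplicities-flatten : (d : Fin n → ℕ) (f : (i : Fin n) → Fin (d i) → A) → multiplicities (flatten d f) ≡ tabulate d
  multiplicities-flatten d f = trans (sym (Vec.tabulate∘lookup _))
    (Vec.tabulate-cong (λ k → trans (lookup-multiplicities-concat (λ i → i) d f k) (sum-indicator* k d)))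

  sum-countFin-isYes : ∀ {m} (h : Fin m → Fin n) → Vec.sum (tabulate (λ k → countFin (λ e → isYes (h e) k))) ≡ m
  sum-countFin-isYes {m = m} h = begin
    Vec.sum (tabulate (λ k → countFin (λ e → isYes (h e) k)))
      ≡⟨ cong Vec.sum (Vec.tabulate-cong (lookup-multiplicities-tabulate h (λ _ → tt))) ⟨
    Vec.sum (tabulate (lookup (multiplicities L)))  ≡⟨ cong Vec.sum (Vec.tabulate∘lookup (multiplicities L)) ⟩
    Vec.sum (multiplicities L)                      ≡⟨ length≡sum-multiplicities L ⟨
    List.length L                                   ≡⟨ List.length-tabulate _ ⟩
    m                                               ∎
    where
    L = List.tabulate (λ e → (h e , tt))

open Exponents

module Coefficients where
  open ≡
  open ≡-Reasoning

  private variable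
    n : ℕ

  coeff-++ : (p q : Poly n) (t : Monomial n) → coeff (p ++ q) t ≡ coeff p t ℤ.+ coeff q t
  coeff-++ []            q t = sym (ℤ.+-identityˡ _)
  coeff-++ ((c , α) ∷ p) q t with Vec.≡-dec ℕ._≟_ α t
  ... | yes _ = trans (cong (λ r → c ℤ.+ r) (coeff-++ p q t)) (sym (ℤ.+-assoc c _ _))
  ... | no _  = coeff-++ p q t

  -- guards a coefficient read at dec i t, which is junk when tᵢ = 0 (dec truncates)
  ifPositive : ℕ → ℤ → ℤ
  ifPositive zero    _ = ℤ.0ℤ
  ifPositive (suc _) x = x

  mulTerm : ℤ → Fin n → ℤ × Monomial n → ℤ × Monomial n
  mulTerm c i (d , α) = c ℤ.* d , inc i α

  coeff-map-mulTerm : (c : ℤ) (i : Fin n) (q : Poly n) (t : Monomial n) →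
    coeff (List.map (mulTerm c i) q) t ≡ ifPositive (lookup t i) (c ℤ.* coeff q (dec i t))
  coeff-map-mulTerm c i [] t with lookup t i
  ... | zero  = refl
  ... | suc _ = sym (ℤ.*-zeroʳ c)
  coeff-map-mulTerm c i ((d , α) ∷ q) t with lookup t i in tᵢ≡
  ... | zero with Vec.≡-dec ℕ._≟_ (inc i α) t
  ...   | yes refl = contradiction (trans (sym tᵢ≡) (lookup-inc-self i α)) ℕ.0≢1+n
  ...   | no _     = trans (coeff-map-mulTerm c i q t) (cong (λ k → ifPositive k (c ℤ.* coeff q (dec i t))) tᵢ≡)
  coeff-map-mulTerm c i ((d , α) ∷ q) t | suc k
    with Vec.≡-dec ℕ._≟_ (inc i α) t | Vec.≡-dec ℕ._≟_ α (dec i t)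
  ... | yes _    | yes _   = begin
    c ℤ.* d ℤ.+ coeff (List.map (mulTerm c i) q) t       ≡⟨ cong (λ r → c ℤ.* d ℤ.+ r) (coeff-map-mulTerm c i q t) ⟩
    c ℤ.* d ℤ.+ ifPositive (lookup t i) (c ℤ.* coeff q (dec i t)) ≡⟨ cong (λ k → c ℤ.* d ℤ.+ ifPositive k (c ℤ.* coeff q (dec i t))) tᵢ≡ ⟩
    c ℤ.* d ℤ.+ c ℤ.* coeff q (dec i t)                   ≡⟨ ℤ.*-distribˡ-+ c d _ ⟨
    c ℤ.* (d ℤ.+ coeff q (dec i t))                       ∎
  ... | yes refl | no α≢   = contradiction (sym (dec-inc i α)) α≢
  ... | no iα≢t  | yes refl = contradiction (inc-dec i t tᵢ≡) iα≢t
  ... | no _     | no _    = trans (coeff-map-mulTerm c i q t) (cong (λ k → ifPositive k (c ℤ.* coeff q (dec i t))) tᵢ≡)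

  coeff-[xᵢ-xⱼ]* : (i j : Fin n) (q : Poly n) (t : Monomial n) →
    coeff ((varP i -P varP j) *P q) t ≡
      ifPositive (lookup t i) (coeff q (dec i t)) ℤ.- ifPositive (lookup t j) (coeff q (dec j t))
  coeff-[xᵢ-xⱼ]* i j q t = begin
    coeff (List.map (mulTerm (ℤ.+ 1) i) q ++ (List.map (mulTerm -1ℤ j) q ++ [])) t
      ≡⟨ coeff-++ (List.map (mulTerm (ℤ.+ 1) i) q) _ t ⟩
    coeff (List.map (mulTerm (ℤ.+ 1) i) q) t ℤ.+ coeff (List.map (mulTerm -1ℤ j) q ++ []) t
      ≡⟨ cong₂ ℤ._+_ (coeff-map-mulTerm (ℤ.+ 1) i q t)
                     (trans (cong (λ r → coeff r t) (List.++-identityʳ (List.map (mulTerm -1ℤ j) q))) (coeff-map-mulTerm -1ℤ j q t)) ⟩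
    ifPositive (lookup t i) (ℤ.+ 1 ℤ.* coeff q (dec i t)) ℤ.+ ifPositive (lookup t j) (-1ℤ ℤ.* coeff q (dec j t))
      ≡⟨ cong₂ ℤ._+_ (cong (ifPositive (lookup t i)) (ℤ.*-identityˡ _)) (cong (ifPositive (lookup t j)) (ℤ.-1*i≡-i _)) ⟩
    ifPositive (lookup t i) (coeff q (dec i t)) ℤ.+ ifPositive (lookup t j) (ℤ.- coeff q (dec j t))
      ≡⟨ cong (λ r → ifPositive (lookup t i) (coeff q (dec i t)) ℤ.+ r) (ifPositive-neg (lookup t j)) ⟩
    ifPositive (lookup t i) (coeff q (dec i t)) ℤ.- ifPositive (lookup t j) (coeff q (dec j t)) ∎
    where
    ifPositive-neg : ∀ k {x} → ifPositive k (ℤ.- x) ≡ ℤ.- ifPositive k x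
    ifPositive-neg zero    = refl
    ifPositive-neg (suc _) = refl

  diffProduct : ∀ {m} → (Fin m → Fin n) → (Fin m → Fin n) → Poly n
  diffProduct a b = prodFinP (λ e → varP (a e) -P varP (b e))

  consArc : (T H : Fin n) → (Monomial n → ℤ) → Monomial n → ℤ
  consArc T H k t = ℤ.- (ℤ.+ lookup t T ℤ.* k (dec T t) ℤ.- ℤ.+ lookup t H ℤ.* k (dec H t))

  -- K a b t = (-1)^m t! [x^t] ∏ₑ (x_{a e} − x_{b e})  (K≡sign*multiFactorial*coeff),
  -- defined by the recursion it shares with the alternating subset sum
  K : ∀ {m} → (Fin m → Fin n) → (Fin m → Fin n) → Monomial n → ℤ
  K {m = zero}  a b = coeff (constP (ℤ.+ 1))
  K {m = suc m} a b = consArc (a Fin.zero) (b Fin.zero) (K (a ∘ Fin.suc) (b ∘ Fin.suc))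

  weight-dec : (i : Fin n) (t : Monomial n) (s X : ℤ) →
    ℤ.+ lookup t i ℤ.* (s ℤ.* (ℤ.+ multiFactorial (dec i t) ℤ.* X)) ≡
    s ℤ.* (ℤ.+ multiFactorial t ℤ.* ifPositive (lookup t i) X)
  weight-dec i t s X with lookup t i in tᵢ≡
  ... | zero  = sym (trans (cong (s ℤ.*_) (ℤ.*-zeroʳ (ℤ.+ multiFactorial t))) (ℤ.*-zeroʳ s))
  ... | suc k = begin
    ℤ.+ suc k ℤ.* (s ℤ.* (ℤ.+ multiFactorial (dec i t) ℤ.* X))  ≡⟨ regroup (ℤ.+ suc k) s (ℤ.+ multiFactorial (dec i t)) X ⟩
    s ℤ.* ((ℤ.+ suc k ℤ.* ℤ.+ multiFactorial (dec i t)) ℤ.* X)  ≡⟨ cong (λ w → s ℤ.* (w ℤ.* X)) (ℤ.pos-* (suc k) (multiFactorial (dec i t))) ⟨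
    s ℤ.* (ℤ.+ (suc k ℕ.* multiFactorial (dec i t)) ℤ.* X)      ≡⟨ cong (λ w → s ℤ.* (ℤ.+ w ℤ.* X)) (multiFactorial-dec i t tᵢ≡) ⟨
    s ℤ.* (ℤ.+ multiFactorial t ℤ.* X)                         ∎
    where
    regroup : ∀ a b c d → a ℤ.* (b ℤ.* (c ℤ.* d)) ≡ b ℤ.* ((a ℤ.* c) ℤ.* d)
    regroup = solve-∀

  K≡sign*multiFactorial*coeff : ∀ {m} (a b : Fin m → Fin n) (t : Monomial n) →
    K a b t ≡ -1ℤ ℤ.^ m ℤ.* (ℤ.+ multiFactorial t ℤ.* coeff (diffProduct a b) t)
  K≡sign*multiFactorial*coeff {n} {zero} a b t with Vec.≡-dec ℕ._≟_ (replicate n 0) t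
  ... | yes refl = cong (λ w → ℤ.+ 1 ℤ.* (ℤ.+ w ℤ.* ℤ.+ 1)) (sym (multiFactorial-replicate-0 n))
  ... | no _     = sym (trans (ℤ.*-identityˡ _) (ℤ.*-zeroʳ (ℤ.+ multiFactorial t)))
  K≡sign*multiFactorial*coeff {m = suc m} a b t = begin
    ℤ.- (ℤ.+ lookup t T ℤ.* K a′ b′ (dec T t) ℤ.- ℤ.+ lookup t H ℤ.* K a′ b′ (dec H t))
      ≡⟨ cong₂ (λ x y → ℤ.- (ℤ.+ lookup t T ℤ.* x ℤ.- ℤ.+ lookup t H ℤ.* y))
               (K≡sign*multiFactorial*coeff a′ b′ (dec T t)) (K≡sign*multiFactorial*coeff a′ b′ (dec H t)) ⟩
    ℤ.- (ℤ.+ lookup t T ℤ.* (s ℤ.* (ℤ.+ multiFactorial (dec T t) ℤ.* C (dec T t)))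
         ℤ.- ℤ.+ lookup t H ℤ.* (s ℤ.* (ℤ.+ multiFactorial (dec H t) ℤ.* C (dec H t))))
      ≡⟨ cong₂ (λ x y → ℤ.- (x ℤ.- y)) (weight-dec T t s _) (weight-dec H t s _) ⟩
    ℤ.- (s ℤ.* (ℤ.+ multiFactorial t ℤ.* ifPositive (lookup t T) (C (dec T t)))
         ℤ.- s ℤ.* (ℤ.+ multiFactorial t ℤ.* ifPositive (lookup t H) (C (dec H t))))
      ≡⟨ factor s (ℤ.+ multiFactorial t) _ _ ⟩
    -1ℤ ℤ.* s ℤ.* (ℤ.+ multiFactorial t ℤ.* (ifPositive (lookup t T) (C (dec T t)) ℤ.- ifPositive (lookup t H) (C (dec H t))))
      ≡⟨ cong (λ w → -1ℤ ℤ.* s ℤ.* (ℤ.+ multiFactorial t ℤ.* w)) (coeff-[xᵢ-xⱼ]* T H (diffProduct a′ b′) t) ⟨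
    -1ℤ ℤ.* s ℤ.* (ℤ.+ multiFactorial t ℤ.* coeff (diffProduct a b) t) ∎
    where
    T = a Fin.zero
    H = b Fin.zero
    a′ = a ∘ Fin.suc
    b′ = b ∘ Fin.suc
    s = -1ℤ ℤ.^ m
    C = coeff (diffProduct a′ b′)
    factor : ∀ s f x y → ℤ.- (s ℤ.* (f ℤ.* x) ℤ.- s ℤ.* (f ℤ.* y)) ≡ -1ℤ ℤ.* s ℤ.* (f ℤ.* (x ℤ.- y))
    factor = solve-∀

  sign*x≡0⇒x≡0 : ∀ k x → -1ℤ ℤ.^ k ℤ.* x ≡ ℤ.0ℤ → x ≡ ℤ.0ℤ
  sign*x≡0⇒x≡0 k x eq with ℤ.i*j≡0⇒i≡0∨j≡0 (-1ℤ ℤ.^ k) eq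
  ... | inj₁ sign≡0 = contradiction (ℤ.i^n≡0⇒i≡0 -1ℤ k sign≡0) λ ()
  ... | inj₂ x≡0    = x≡0

  K≡0⇔coeff≡0 : ∀ {m} (a b : Fin m → Fin n) (t : Monomial n) →
    K a b t ≡ ℤ.0ℤ ⇔ coeff (diffProduct a b) t ≡ ℤ.0ℤ
  K≡0⇔coeff≡0 {m = m} a b t = mk⇔ to from
    where
    to : K a b t ≡ ℤ.0ℤ → coeff (diffProduct a b) t ≡ ℤ.0ℤ
    to K≡0 with ℤ.i*j≡0⇒i≡0∨j≡0 (ℤ.+ multiFactorial t)
                  (sign*x≡0⇒x≡0 m _ (trans (sym (K≡sign*multiFactorial*coeff a b t)) K≡0))
    ... | inj₁ t!≡0 = contradiction (ℤ.+-injective t!≡0) (ℕ.≢-nonZero⁻¹ _ {{multiFactorial-nonZero t}})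
    ... | inj₂ c≡0  = c≡0
    from : coeff (diffProduct a b) t ≡ ℤ.0ℤ → K a b t ≡ ℤ.0ℤ
    from c≡0 = begin
      K a b t                                                           ≡⟨ K≡sign*multiFactorial*coeff a b t ⟩
      -1ℤ ℤ.^ m ℤ.* (ℤ.+ multiFactorial t ℤ.* coeff (diffProduct a b) t) ≡⟨ cong (λ c → -1ℤ ℤ.^ m ℤ.* (ℤ.+ multiFactorial t ℤ.* c)) c≡0 ⟩
      -1ℤ ℤ.^ m ℤ.* (ℤ.+ multiFactorial t ℤ.* ℤ.0ℤ)                     ≡⟨ cong (-1ℤ ℤ.^ m ℤ.*_) (ℤ.*-zeroʳ (ℤ.+ multiFactorial t)) ⟩
      -1ℤ ℤ.^ m ℤ.* ℤ.0ℤ                                                ≡⟨ ℤ.*-zeroʳ (-1ℤ ℤ.^ m) ⟩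
      ℤ.0ℤ                                                              ∎

  weight*≢0⇒sum≡suc : (i : Fin n) (t : Monomial n) (k : Monomial n → ℤ) (d : ℕ) →
    (∀ t′ → k t′ ≢ ℤ.0ℤ → Vec.sum t′ ≡ d) →
    ℤ.+ lookup t i ℤ.* k (dec i t) ≢ ℤ.0ℤ → Vec.sum t ≡ suc d
  weight*≢0⇒sum≡suc i t k d k-homog term≢0 with lookup t i in tᵢ≡
  ... | zero  = contradiction refl term≢0
  ... | suc j = begin
    Vec.sum t                  ≡⟨ cong Vec.sum (inc-dec i t tᵢ≡) ⟨
    Vec.sum (inc i (dec i t))  ≡⟨ sum-inc i (dec i t) ⟩
    suc (Vec.sum (dec i t))    ≡⟨ cong suc (k-homog (dec i t) (λ k≡0 → term≢0 (trans (cong (ℤ.+ suc j ℤ.*_) k≡0) (ℤ.*-zeroʳ (ℤ.+ suc j))))) ⟩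
    suc d                      ∎

  K-homogeneous : ∀ {m} (a b : Fin m → Fin n) (t : Monomial n) → K a b t ≢ ℤ.0ℤ → Vec.sum t ≡ m
  K-homogeneous {n} {zero} a b t K≢0 with Vec.≡-dec ℕ._≟_ (replicate n 0) t
  ... | yes refl = sum-replicate-0 n
  ... | no _     = contradiction refl K≢0
  K-homogeneous {m = suc m} a b t K≢0 with ℤ._≟_ (ℤ.+ lookup t T ℤ.* K a′ b′ (dec T t)) ℤ.0ℤ
    where
    T = a Fin.zero
    a′ = a ∘ Fin.suc
    b′ = b ∘ Fin.suc
  ... | no  left≢0 = weight*≢0⇒sum≡suc (a Fin.zero) t _ m (K-homogeneous _ _) left≢0
  ... | yes left≡0 = weight*≢0⇒sum≡suc (b Fin.zero) t _ m (K-homogeneous _ _)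
                       (λ right≡0 → K≢0 (cong₂ (λ x y → ℤ.- (x ℤ.- y)) left≡0 right≡0))

  consArc-scale : (T H : Fin n) {k k′ : Monomial n → ℤ} (s : ℤ) → (∀ t → k t ≡ s ℤ.* k′ t) →
                  ∀ t → consArc T H k t ≡ s ℤ.* consArc T H k′ t
  consArc-scale T H {k} {k′} s k≡sk′ t = begin
    ℤ.- (ℤ.+ lookup t T ℤ.* k (dec T t) ℤ.- ℤ.+ lookup t H ℤ.* k (dec H t))
      ≡⟨ cong₂ (λ x y → ℤ.- (ℤ.+ lookup t T ℤ.* x ℤ.- ℤ.+ lookup t H ℤ.* y)) (k≡sk′ (dec T t)) (k≡sk′ (dec H t)) ⟩
    ℤ.- (ℤ.+ lookup t T ℤ.* (s ℤ.* k′ (dec T t)) ℤ.- ℤ.+ lookup t H ℤ.* (s ℤ.* k′ (dec H t)))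
      ≡⟨ pull (ℤ.+ lookup t T) (ℤ.+ lookup t H) s (k′ (dec T t)) (k′ (dec H t)) ⟩
    s ℤ.* consArc T H k′ t ∎
    where
    pull : ∀ p q s x y → ℤ.- (p ℤ.* (s ℤ.* x) ℤ.- q ℤ.* (s ℤ.* y)) ≡ s ℤ.* ℤ.- (p ℤ.* x ℤ.- q ℤ.* y)
    pull = solve-∀

  consArc-swap : (T H : Fin n) (k : Monomial n → ℤ) (t : Monomial n) → consArc T H k t ≡ -1ℤ ℤ.* consArc H T k t
  consArc-swap T H k t = swap (ℤ.+ lookup t T) (ℤ.+ lookup t H) (k (dec T t)) (k (dec H t))
    where
    swap : ∀ p q x y → ℤ.- (p ℤ.* x ℤ.- q ℤ.* y) ≡ -1ℤ ℤ.* ℤ.- (q ℤ.* y ℤ.- p ℤ.* x)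
    swap = solve-∀

  SameEnds : ∀ {m} (tl hd a b : Fin m → Fin n) → Set
  SameEnds tl hd a b = ∀ e → (tl e ≡ a e × hd e ≡ b e) ⊎ (tl e ≡ b e × hd e ≡ a e)

  K-reorient : ∀ {m} (tl hd a b : Fin m → Fin n) → SameEnds tl hd a b →
               ∃ λ k → ∀ t → K tl hd t ≡ -1ℤ ℤ.^ k ℤ.* K a b t
  K-reorient {m = zero}  tl hd a b _ = 0 , λ t → sym (ℤ.*-identityˡ _)
  K-reorient {m = suc m} tl hd a b same
    with K-reorient (tl ∘ Fin.suc) (hd ∘ Fin.suc) (a ∘ Fin.suc) (b ∘ Fin.suc) (same ∘ Fin.suc) | same Fin.zero
  ... | k , K′≡ | inj₁ (tl≡a , hd≡b) = k , λ t →
    trans (cong₂ (λ x y → consArc x y (K (tl ∘ Fin.suc) (hd ∘ Fin.suc)) t) tl≡a hd≡b) (consArc-scale _ _ (-1ℤ ℤ.^ k) K′≡ t)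
  ... | k , K′≡ | inj₂ (tl≡b , hd≡a) = suc k , λ t → begin
    consArc (tl Fin.zero) (hd Fin.zero) K′ t               ≡⟨ cong₂ (λ x y → consArc x y K′ t) tl≡b hd≡a ⟩
    consArc (b Fin.zero) (a Fin.zero) K′ t                 ≡⟨ consArc-scale _ _ (-1ℤ ℤ.^ k) K′≡ t ⟩
    -1ℤ ℤ.^ k ℤ.* consArc (b Fin.zero) (a Fin.zero) K′ab t ≡⟨ cong (-1ℤ ℤ.^ k ℤ.*_) (consArc-swap _ _ K′ab t) ⟩
    -1ℤ ℤ.^ k ℤ.* (-1ℤ ℤ.* K a b t)                        ≡⟨ ℤ.*-assoc (-1ℤ ℤ.^ k) -1ℤ (K a b t) ⟨
    -1ℤ ℤ.^ k ℤ.* -1ℤ ℤ.* K a b t                          ≡⟨ cong (ℤ._* K a b t) (ℤ.*-comm (-1ℤ ℤ.^ k) -1ℤ) ⟩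
    -1ℤ ℤ.^ suc k ℤ.* K a b t                              ∎
    where
    K′ = K (tl ∘ Fin.suc) (hd ∘ Fin.suc)
    K′ab = K (a ∘ Fin.suc) (b ∘ Fin.suc)

  K≡0-reorient : ∀ {m} (tl hd a b : Fin m → Fin n) → SameEnds tl hd a b →
                 (t : Monomial n) → K tl hd t ≡ ℤ.0ℤ ⇔ K a b t ≡ ℤ.0ℤ
  K≡0-reorient tl hd a b same t with K-reorient tl hd a b same
  ... | k , K≡ = mk⇔ (λ K≡0 → sign*x≡0⇒x≡0 k _ (trans (sym (K≡ t)) K≡0))
                     (λ K′≡0 → trans (K≡ t) (trans (cong (-1ℤ ℤ.^ k ℤ.*_) K′≡0) (ℤ.*-zeroʳ (-1ℤ ℤ.^ k))))

open Coefficients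

module AlternatingSums {c ℓ} (R : CommutativeRing c ℓ) where
  open CommutativeRing R hiding (zero)
  open RingOps R
  open import Algebra.Properties.Ring ring
    using (-‿distribˡ-*; -‿involutive; -0#≈0#; -‿+-comm; x[y-z]≈xy-xz; [y-z]x≈yx-zx; -1*x≈-x)
  open import Algebra.Properties.CommutativeSemigroup +-commutativeSemigroup using (interchange)
  open import Algebra.Properties.CommutativeSemigroup *-commutativeSemigroup using (x∙yz≈y∙xz)
  open import Relation.Binary.Reasoning.Setoid setoid

  private variable
    n : ℕ
    a : Level
    A : Set a

  [p-q]+[r-s]≈[p+r]-[q+s] : ∀ p q r s → (p - q) + (r - s) ≈ (p + r) - (q + s)
  [p-q]+[r-s]≈[p+r]-[q+s] p q r s = trans (interchange p (- q) r (- s)) (+-congˡ (-‿+-comm q s))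

  [x+d]-w≈x-[w-d] : ∀ x d w → (x + d) - w ≈ x - (w - d)
  [x+d]-w≈x-[w-d] x d w = begin
    (x + d) + - w      ≈⟨ +-assoc x d (- w) ⟩
    x + (d + - w)      ≈⟨ +-congˡ (+-comm d (- w)) ⟩
    x + (- w + d)      ≈⟨ +-congˡ (+-congˡ (-‿involutive d)) ⟨
    x + (- w + - - d)  ≈⟨ +-congˡ (-‿+-comm w (- d)) ⟩
    x + - (w + - d)    ∎

  -[x-y]≈-x+y : ∀ x y → - (x - y) ≈ - x + y
  -[x-y]≈-x+y x y = trans (sym (-‿+-comm x (- y))) (+-congˡ (-‿involutive y))

  fromℕ-+ : ∀ m n → fromℕ (m ℕ.+ n) ≈ fromℕ m + fromℕ n
  fromℕ-+ zero    n = sym (+-identityˡ _)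
  fromℕ-+ (suc m) n = trans (+-congˡ (fromℕ-+ m n)) (sym (+-assoc _ _ _))

  fromℤ : ℤ → Carrier
  fromℤ (ℤ.+ k)    = fromℕ k
  fromℤ ℤ.-[1+ k ] = - fromℕ (suc k)

  fromℤ-neg : ∀ x → fromℤ (ℤ.- x) ≈ - fromℤ x
  fromℤ-neg (ℤ.+ zero)  = sym -0#≈0#
  fromℤ-neg (ℤ.+ suc k) = refl
  fromℤ-neg ℤ.-[1+ k ]  = sym (-‿involutive _)

  fromℤ-⊖ : ∀ m n → fromℤ (m ℤ.⊖ n) ≈ fromℕ m - fromℕ n
  fromℤ-⊖ zero n = begin
    fromℤ (zero ℤ.⊖ n)   ≈⟨ reflexive (≡.cong fromℤ (ℤ.⊖-≤ {0} {n} z≤n)) ⟩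
    fromℤ (ℤ.- ℤ.+ n)    ≈⟨ fromℤ-neg (ℤ.+ n) ⟩
    - fromℕ n            ≈⟨ +-identityˡ _ ⟨
    0# - fromℕ n         ∎
  fromℤ-⊖ (suc m) zero = begin
    fromℤ (suc m ℤ.⊖ zero) ≈⟨ reflexive (≡.cong fromℤ (ℤ.⊖-≥ {suc m} {0} z≤n)) ⟩
    fromℕ (suc m)          ≈⟨ +-identityʳ _ ⟨
    fromℕ (suc m) + 0#     ≈⟨ +-congˡ -0#≈0# ⟨
    fromℕ (suc m) - 0#     ∎
  fromℤ-⊖ (suc m) (suc n) = begin
    fromℤ (suc m ℤ.⊖ suc n)          ≈⟨ reflexive (≡.cong fromℤ (ℤ.[1+m]⊖[1+n]≡m⊖n m n)) ⟩
    fromℤ (m ℤ.⊖ n)                  ≈⟨ fromℤ-⊖ m n ⟩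
    fromℕ m - fromℕ n                ≈⟨ +-identityˡ _ ⟨
    0# + (fromℕ m - fromℕ n)         ≈⟨ +-congʳ (-‿inverseʳ 1#) ⟨
    (1# - 1#) + (fromℕ m - fromℕ n)  ≈⟨ [p-q]+[r-s]≈[p+r]-[q+s] 1# 1# _ _ ⟩
    fromℕ (suc m) - fromℕ (suc n)    ∎

  fromℤ-+ : ∀ x y → fromℤ (x ℤ.+ y) ≈ fromℤ x + fromℤ y
  fromℤ-+ (ℤ.+ m)    (ℤ.+ n)    = fromℕ-+ m n
  fromℤ-+ (ℤ.+ m)    ℤ.-[1+ n ] = fromℤ-⊖ m (suc n)
  fromℤ-+ ℤ.-[1+ m ] (ℤ.+ n)    = trans (fromℤ-⊖ n (suc m)) (+-comm _ _)
  fromℤ-+ ℤ.-[1+ m ] ℤ.-[1+ n ] = begin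
    - fromℕ (suc (suc (m ℕ.+ n)))       ≈⟨ -‿cong (reflexive (≡.cong (fromℕ ∘ suc) (ℕ.+-suc m n))) ⟨
    - fromℕ (suc m ℕ.+ suc n)           ≈⟨ -‿cong (fromℕ-+ (suc m) (suc n)) ⟩
    - (fromℕ (suc m) + fromℕ (suc n))   ≈⟨ -‿+-comm _ _ ⟨
    - fromℕ (suc m) + - fromℕ (suc n)   ∎

  fromℤ-- : ∀ x y → fromℤ (x ℤ.- y) ≈ fromℤ x - fromℤ y
  fromℤ-- x y = trans (fromℤ-+ x (ℤ.- y)) (+-congˡ (fromℤ-neg y))

  fromℤ-+* : ∀ k x → fromℤ (ℤ.+ k ℤ.* x) ≈ fromℕ k * fromℤ x
  fromℤ-+* zero    x = sym (zeroˡ _)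
  fromℤ-+* (suc k) x = begin
    fromℤ (ℤ.+ suc k ℤ.* x)                  ≈⟨ reflexive (≡.cong fromℤ (ℤ.*-distribʳ-+ x (ℤ.+ 1) (ℤ.+ k))) ⟩
    fromℤ (ℤ.+ 1 ℤ.* x ℤ.+ ℤ.+ k ℤ.* x)      ≈⟨ fromℤ-+ (ℤ.+ 1 ℤ.* x) _ ⟩
    fromℤ (ℤ.+ 1 ℤ.* x) + fromℤ (ℤ.+ k ℤ.* x) ≈⟨ +-cong (reflexive (≡.cong fromℤ (ℤ.*-identityˡ x))) (fromℤ-+* k x) ⟩
    fromℤ x + fromℕ k * fromℤ x              ≈⟨ +-congʳ (*-identityˡ _) ⟨
    1# * fromℤ x + fromℕ k * fromℤ x         ≈⟨ distribʳ _ _ _ ⟨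
    fromℕ (suc k) * fromℤ x                  ∎

  fromℤ-consArc : (T H : Fin n) (k : Monomial n → ℤ) (t : Monomial n) →
    fromℤ (consArc T H k t) ≈ - (fromℕ (lookup t T) * fromℤ (k (dec T t)) - fromℕ (lookup t H) * fromℤ (k (dec H t)))
  fromℤ-consArc T H k t = trans (fromℤ-neg (X ℤ.- Y)) (-‿cong (trans (fromℤ-- X Y)
    (+-cong (fromℤ-+* (lookup t T) (k (dec T t))) (-‿cong (fromℤ-+* (lookup t H) (k (dec H t)))))))
    where
    X = ℤ.+ lookup t T ℤ.* k (dec T t)
    Y = ℤ.+ lookup t H ℤ.* k (dec H t)

  fromℤ≈0⇔≡0 : CharZero → ∀ x → fromℤ x ≈ 0# ⇔ x ≡ ℤ.0ℤ
  fromℤ≈0⇔≡0 char0 x = mk⇔ (to x) λ { ≡.refl → refl }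
    where
    to : ∀ x → fromℤ x ≈ 0# → x ≡ ℤ.0ℤ
    to (ℤ.+ zero)  _  = ≡.refl
    to (ℤ.+ suc k) eq = contradiction eq (char0 k)
    to ℤ.-[1+ k ]  eq = contradiction (trans (sym (-‿involutive _)) (trans (-‿cong eq) -0#≈0#)) (char0 k)

  ∑ : List A → (A → Carrier) → Carrier
  ∑ xs f = sumL (List.map f xs)

  ∑-cong : (xs : List A) {f g : A → Carrier} → (∀ x → f x ≈ g x) → ∑ xs f ≈ ∑ xs g
  ∑-cong []       f≈g = refl
  ∑-cong (x ∷ xs) f≈g = +-cong (f≈g x) (∑-cong xs f≈g)

  ∑-cong-All : ∀ {p} {P : A → Set p} (xs : List A) {f g : A → Carrier} →
               (∀ x → P x → f x ≈ g x) → All P xs → ∑ xs f ≈ ∑ xs g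
  ∑-cong-All []       f≈g []         = refl
  ∑-cong-All (x ∷ xs) f≈g (px ∷ pxs) = +-cong (f≈g x px) (∑-cong-All xs f≈g pxs)

  ∑-zero : (xs : List A) → ∑ xs (λ _ → 0#) ≈ 0#
  ∑-zero []       = refl
  ∑-zero (x ∷ xs) = trans (+-identityˡ _) (∑-zero xs)

  ∑-distrib-+ : (xs : List A) (f g : A → Carrier) → ∑ xs (λ x → f x + g x) ≈ ∑ xs f + ∑ xs g
  ∑-distrib-+ []       f g = sym (+-identityˡ 0#)
  ∑-distrib-+ (x ∷ xs) f g = trans (+-congˡ (∑-distrib-+ xs f g)) (interchange _ _ _ _)

  ∑-distribˡ-* : (xs : List A) (k : Carrier) (f : A → Carrier) → ∑ xs (λ x → k * f x) ≈ k * ∑ xs f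
  ∑-distribˡ-* []       k f = sym (zeroʳ k)
  ∑-distribˡ-* (x ∷ xs) k f = trans (+-congˡ (∑-distribˡ-* xs k f)) (sym (distribˡ k _ _))

  ∑-neg : (xs : List A) (f : A → Carrier) → ∑ xs (λ x → - f x) ≈ - ∑ xs f
  ∑-neg []       f = sym -0#≈0#
  ∑-neg (x ∷ xs) f = trans (+-congˡ (∑-neg xs f)) (-‿+-comm _ _)

  ∑-++ : (xs ys : List A) (f : A → Carrier) → ∑ (xs ++ ys) f ≈ ∑ xs f + ∑ ys f
  ∑-++ []       ys f = sym (+-identityˡ _)
  ∑-++ (x ∷ xs) ys f = trans (+-congˡ (∑-++ xs ys f)) (sym (+-assoc _ _ _))

  ∑-map : ∀ {b} {B : Set b} (h : A → B) (xs : List A) (f : B → Carrier) → ∑ (List.map h xs) f ≡ ∑ xs (f ∘ h)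
  ∑-map h []       f = ≡.refl
  ∑-map h (x ∷ xs) f = ≡.cong (f (h x) +_) (∑-map h xs f)

  ∑-comm : ∀ {b} {B : Set b} (xs : List A) (ys : List B) (h : A → B → Carrier) →
           ∑ xs (λ x → ∑ ys (h x)) ≈ ∑ ys (λ y → ∑ xs (λ x → h x y))
  ∑-comm []       ys h = sym (∑-zero ys)
  ∑-comm (x ∷ xs) ys h = begin
    ∑ ys (h x) + ∑ xs (λ x → ∑ ys (h x))             ≈⟨ +-congˡ (∑-comm xs ys h) ⟩
    ∑ ys (h x) + ∑ ys (λ y → ∑ xs (λ x → h x y))     ≈⟨ ∑-distrib-+ ys (h x) _ ⟨
    ∑ ys (λ y → h x y + ∑ xs (λ x → h x y))          ∎

  netOutdeg : ∀ {m} (tl hd : Fin m → Fin n) → ArcSet m → Fin n → Carrier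
  netOutdeg tl hd A i = fromℕ (countFin (λ e → lookup A e ∧ isYes (tl e) i))
                      - fromℕ (countFin (λ e → lookup A e ∧ isYes (hd e) i))

  Factor : ℕ → Set c
  Factor n = Fin n × Carrier

  linProd : List (Factor n) → (Fin n → Carrier) → Carrier
  linProd []            y = 1#
  linProd ((i , w) ∷ L) y = (y i - w) * linProd L y

  altSum : ∀ {m} (tl hd : Fin m → Fin n) → List (Factor n) → Carrier
  altSum {m = m} tl hd L = ∑ (allSubsets m) (λ A → pow (- 1#) (card A) * linProd L (netOutdeg tl hd A))

  shift : (Fin n → Carrier) → List (Factor n) → List (Factor n)
  shift d = List.map (λ (i , w) → i , w - d i)

  -- one entry (i , L′) per factor (i , w) of L, where L′ drops it and shifts the factors after it
  telescope : (Fin n → Carrier) → List (Factor n) → List (Fin n × List (Factor n))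
  telescope d []            = []
  telescope d ((i , w) ∷ L) = (i , shift d L) ∷ List.map (λ (j , L′) → j , (i , w) ∷ L′) (telescope d L)

  arcVec : (T H : Fin n) → Fin n → Carrier
  arcVec T H i = fromℕ (indicator (isYes T i)) - fromℕ (indicator (isYes H i))

  linProd-cong : (L : List (Factor n)) {y z : Fin n → Carrier} → (∀ i → y i ≈ z i) → linProd L y ≈ linProd L z
  linProd-cong []            y≈z = refl
  linProd-cong ((i , w) ∷ L) y≈z = *-cong (+-congʳ (y≈z i)) (linProd-cong L y≈z)

  linProd-shift : (d : Fin n → Carrier) (L : List (Factor n)) (y : Fin n → Carrier) →
                  linProd L (λ i → y i + d i) ≈ linProd (shift d L) y
  linProd-shift d []            y = refl
  linProd-shift d ((i , w) ∷ L) y = *-cong ([x+d]-w≈x-[w-d] (y i) (d i) w) (linProd-shift d L y)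

  linProd-telescope : (d : Fin n → Carrier) (L : List (Factor n)) (y : Fin n → Carrier) →
    linProd (shift d L) y - linProd L y ≈ ∑ (telescope d L) (λ (j , L′) → d j * linProd L′ y)
  linProd-telescope d []            y = -‿inverseʳ 1#
  linProd-telescope d ((i , w) ∷ L) y = begin
    (y i - (w - d i)) * P′ - (y i - w) * P
      ≈⟨ +-congʳ (*-congʳ (trans (sym ([x+d]-w≈x-[w-d] (y i) (d i) w)) (x+d-w≈x-w+d (y i) (d i) w))) ⟩
    ((y i - w) + d i) * P′ - (y i - w) * P
      ≈⟨ +-congʳ (distribʳ P′ (y i - w) (d i)) ⟩
    ((y i - w) * P′ + d i * P′) - (y i - w) * P
      ≈⟨ x+y-z≈y+[x-z] _ _ _ ⟩
    d i * P′ + ((y i - w) * P′ - (y i - w) * P)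
      ≈⟨ +-congˡ (x[y-z]≈xy-xz (y i - w) P′ P) ⟨
    d i * P′ + (y i - w) * (P′ - P)
      ≈⟨ +-congˡ (*-congˡ (linProd-telescope d L y)) ⟩
    d i * P′ + (y i - w) * ∑ (telescope d L) g
      ≈⟨ +-congˡ (∑-distribˡ-* (telescope d L) (y i - w) g) ⟨
    d i * P′ + ∑ (telescope d L) (λ q → (y i - w) * g q)
      ≈⟨ +-congˡ (∑-cong (telescope d L) (λ (j , L′) → x∙yz≈y∙xz (y i - w) (d j) (linProd L′ y))) ⟩
    d i * P′ + ∑ (telescope d L) (λ (j , L′) → d j * ((y i - w) * linProd L′ y))
      ≈⟨ +-congˡ (reflexive (∑-map (λ (j , L′) → j , (i , w) ∷ L′) (telescope d L) g)) ⟨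
    ∑ (telescope d ((i , w) ∷ L)) g ∎
    where
    P′ = linProd (shift d L) y
    P  = linProd L y
    g : Fin _ × List (Factor _) → Carrier
    g (j , L′) = d j * linProd L′ y
    x+d-w≈x-w+d : ∀ x d w → (x + d) - w ≈ (x - w) + d
    x+d-w≈x-w+d x d w = trans (+-assoc x d (- w)) (trans (+-congˡ (+-comm d (- w))) (sym (+-assoc x (- w) d)))
    x+y-z≈y+[x-z] : ∀ x y z → (x + y) - z ≈ y + (x - z)
    x+y-z≈y+[x-z] x y z = trans (+-congʳ (+-comm x y)) (+-assoc y x (- z))

  netOutdeg-true : ∀ {m} (tl hd : Fin (suc m) → Fin n) (A : ArcSet m) (i : Fin n) →
    netOutdeg tl hd (true ∷ A) i ≈ netOutdeg (tl ∘ Fin.suc) (hd ∘ Fin.suc) A i + arcVec (tl Fin.zero) (hd Fin.zero) i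
  netOutdeg-true tl hd A i = begin
    fromℕ (x ℕ.+ X) - fromℕ (y ℕ.+ Y)          ≈⟨ +-cong (fromℕ-+ x X) (-‿cong (fromℕ-+ y Y)) ⟩
    (fromℕ x + fromℕ X) - (fromℕ y + fromℕ Y)  ≈⟨ [p-q]+[r-s]≈[p+r]-[q+s] _ _ _ _ ⟨
    (fromℕ x - fromℕ y) + (fromℕ X - fromℕ Y)  ≈⟨ +-comm _ _ ⟩
    (fromℕ X - fromℕ Y) + (fromℕ x - fromℕ y)  ∎
    where
    x = indicator (isYes (tl Fin.zero) i)
    y = indicator (isYes (hd Fin.zero) i)
    X = countFin (λ e → lookup A e ∧ isYes (tl (Fin.suc e)) i)
    Y = countFin (λ e → lookup A e ∧ isYes (hd (Fin.suc e)) i)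

  -- on the subsets containing the first arc T → H, netOutdeg is shifted by arcVec T H
  altSum-suc : ∀ {m} (tl hd : Fin (suc m) → Fin n) (L : List (Factor n)) →
    altSum tl hd L ≈ - altSum (tl ∘ Fin.suc) (hd ∘ Fin.suc) (shift (arcVec (tl Fin.zero) (hd Fin.zero)) L)
                     + altSum (tl ∘ Fin.suc) (hd ∘ Fin.suc) L
  altSum-suc {m = m} tl hd L = begin
    ∑ (List.map (true ∷_) S ++ List.map (false ∷_) S) f
      ≈⟨ ∑-++ (List.map (true ∷_) S) _ f ⟩
    ∑ (List.map (true ∷_) S) f + ∑ (List.map (false ∷_) S) f
      ≈⟨ reflexive (≡.cong₂ _+_ (∑-map (true ∷_) S f) (∑-map (false ∷_) S f)) ⟩
    ∑ S (λ A → f (true ∷ A)) + ∑ S (λ A → f (false ∷ A))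
      ≈⟨ +-congʳ (trans (∑-cong S with-first-arc) (∑-neg S _)) ⟩
    - altSum tl′ hd′ (shift d L) + altSum tl′ hd′ L ∎
    where
    S = allSubsets m
    tl′ = tl ∘ Fin.suc
    hd′ = hd ∘ Fin.suc
    d = arcVec (tl Fin.zero) (hd Fin.zero)
    f : ArcSet (suc m) → Carrier
    f A = pow (- 1#) (card A) * linProd L (netOutdeg tl hd A)
    with-first-arc : ∀ A → f (true ∷ A) ≈ - (pow (- 1#) (card A) * linProd (shift d L) (netOutdeg tl′ hd′ A))
    with-first-arc A = begin
      (- 1# * pow (- 1#) (card A)) * linProd L (netOutdeg tl hd (true ∷ A))
        ≈⟨ *-cong (-1*x≈-x _) (trans (linProd-cong L (netOutdeg-true tl hd A)) (linProd-shift d L (netOutdeg tl′ hd′ A))) ⟩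
      (- pow (- 1#) (card A)) * linProd (shift d L) (netOutdeg tl′ hd′ A)
        ≈⟨ -‿distribˡ-* _ _ ⟨
      - (pow (- 1#) (card A) * linProd (shift d L) (netOutdeg tl′ hd′ A)) ∎

  altSum-telescope : ∀ {m} (tl hd : Fin m → Fin n) (d : Fin n → Carrier) (L : List (Factor n)) →
    altSum tl hd (shift d L) - altSum tl hd L ≈ ∑ (telescope d L) (λ (j , L′) → d j * altSum tl hd L′)
  altSum-telescope {m = m} tl hd d L = begin
    ∑ S (λ A → p A * linProd (shift d L) (y A)) - ∑ S (λ A → p A * linProd L (y A))
      ≈⟨ +-congˡ (∑-neg S _) ⟨
    ∑ S (λ A → p A * linProd (shift d L) (y A)) + ∑ S (λ A → - (p A * linProd L (y A)))
      ≈⟨ ∑-distrib-+ S _ _ ⟨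
    ∑ S (λ A → p A * linProd (shift d L) (y A) - p A * linProd L (y A))
      ≈⟨ ∑-cong S (λ A → trans (sym (x[y-z]≈xy-xz _ _ _)) (*-congˡ (linProd-telescope d L (y A)))) ⟩
    ∑ S (λ A → p A * ∑ T (λ (j , L′) → d j * linProd L′ (y A)))
      ≈⟨ ∑-cong S (λ A → ∑-distribˡ-* T (p A) _) ⟨
    ∑ S (λ A → ∑ T (λ (j , L′) → p A * (d j * linProd L′ (y A))))
      ≈⟨ ∑-comm S T _ ⟩
    ∑ T (λ (j , L′) → ∑ S (λ A → p A * (d j * linProd L′ (y A))))
      ≈⟨ ∑-cong T (λ (j , L′) → trans (∑-cong S (λ A → x∙yz≈y∙xz (p A) (d j) _)) (∑-distribˡ-* S (d j) _)) ⟩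
    ∑ T (λ (j , L′) → d j * altSum tl hd L′) ∎
    where
    S = allSubsets m
    T = telescope d L
    p : ArcSet m → Carrier
    p A = pow (- 1#) (card A)
    y = netOutdeg tl hd

  multiplicities-shift : (d : Fin n → Carrier) (L : List (Factor n)) → multiplicities (shift d L) ≡ multiplicities L
  multiplicities-shift d []            = ≡.refl
  multiplicities-shift d ((i , w) ∷ L) = ≡.cong (inc i) (multiplicities-shift d L)

  IsDeletion : List (Factor n) → Fin n × List (Factor n) → Set
  IsDeletion L (j , L′) = suc (List.length L′) ≡ List.length L × multiplicities L ≡ inc j (multiplicities L′)

  telescope-deletions : (d : Fin n → Carrier) (L : List (Factor n)) → All (IsDeletion L) (telescope d L)
  telescope-deletions d []            = []
  telescope-deletions d ((i , w) ∷ L) =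
    (≡.cong suc (List.length-map _ L) , ≡.cong (inc i) (≡.sym (multiplicities-shift d L)))
    ∷ All.map⁺ (All.map (λ {q} → keep-first {q}) (telescope-deletions d L))
    where
    keep-first : ∀ {q} → IsDeletion L q → IsDeletion ((i , w) ∷ L) (proj₁ q , (i , w) ∷ proj₂ q)
    keep-first {j , L′} (len≡ , mult≡) = ≡.cong suc len≡ , ≡.trans (≡.cong (inc i) mult≡) (inc-comm i j _)

  fromℕ-indicator-* : (T i : Fin n) (φ : Fin n → Carrier) →
    fromℕ (indicator (isYes T i)) * φ i ≈ fromℕ (indicator (isYes T i)) * φ T
  fromℕ-indicator-* T i φ with T ≟ᶠ i
  ... | yes ≡.refl = refl
  ... | no _       = trans (zeroˡ _) (sym (zeroˡ _))

  ∑-telescope-arcVec : (T H : Fin n) (φ : Fin n → Carrier) (L : List (Factor n)) →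
    ∑ (telescope (arcVec T H) L) (λ (j , _) → arcVec T H j * φ j) ≈
      fromℕ (lookup (multiplicities L) T) * φ T - fromℕ (lookup (multiplicities L) H) * φ H
  ∑-telescope-arcVec T H φ [] = sym (begin
    fromℕ (lookup (replicate _ 0) T) * φ T - fromℕ (lookup (replicate _ 0) H) * φ H
      ≈⟨ reflexive (≡.cong₂ (λ x y → fromℕ x * φ T - fromℕ y * φ H) (Vec.lookup-replicate T 0) (Vec.lookup-replicate H 0)) ⟩
    0# * φ T - 0# * φ H ≈⟨ +-cong (zeroˡ _) (trans (-‿cong (zeroˡ _)) -0#≈0#) ⟩
    0# + 0#             ≈⟨ +-identityʳ 0# ⟩
    0#                  ∎)
  ∑-telescope-arcVec T H φ ((i , w) ∷ L) = begin
    arcVec T H i * φ i + ∑ (List.map (λ (j , L′) → j , (i , w) ∷ L′) (telescope (arcVec T H) L)) f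
      ≈⟨ +-cong ([y-z]x≈yx-zx (φ i) _ _) (reflexive (∑-map _ (telescope (arcVec T H) L) f)) ⟩
    (fromℕ iT * φ i - fromℕ iH * φ i) + ∑ (telescope (arcVec T H) L) f
      ≈⟨ +-cong (+-cong (fromℕ-indicator-* T i φ) (-‿cong (fromℕ-indicator-* H i φ))) (∑-telescope-arcVec T H φ L) ⟩
    (fromℕ iT * φ T - fromℕ iH * φ H) + (fromℕ cT * φ T - fromℕ cH * φ H)
      ≈⟨ [p-q]+[r-s]≈[p+r]-[q+s] _ _ _ _ ⟩
    (fromℕ iT * φ T + fromℕ cT * φ T) - (fromℕ iH * φ H + fromℕ cH * φ H)
      ≈⟨ +-cong (sym (distribʳ _ _ _)) (-‿cong (sym (distribʳ _ _ _))) ⟩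
    (fromℕ iT + fromℕ cT) * φ T - (fromℕ iH + fromℕ cH) * φ H
      ≈⟨ +-cong (*-congʳ (fromℕ-+ iT cT)) (-‿cong (*-congʳ (fromℕ-+ iH cH))) ⟨
    fromℕ (iT ℕ.+ cT) * φ T - fromℕ (iH ℕ.+ cH) * φ H
      ≈⟨ reflexive (≡.cong₂ (λ x y → fromℕ x * φ T - fromℕ y * φ H) (lookup-inc i T (multiplicities L)) (lookup-inc i H (multiplicities L))) ⟨
    fromℕ (lookup (inc i (multiplicities L)) T) * φ T - fromℕ (lookup (inc i (multiplicities L)) H) * φ H ∎
    where
    f : Fin _ × List (Factor _) → Carrier
    f (j , _) = arcVec T H j * φ j
    iT = indicator (isYes T i)
    iH = indicator (isYes H i)
    cT = lookup (multiplicities L) T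
    cH = lookup (multiplicities L) H

  altSum≈fromℤ-K : ∀ {m} (tl hd : Fin m → Fin n) (L : List (Factor n)) → List.length L ≤ m →
                   altSum tl hd L ≈ fromℤ (K tl hd (multiplicities L))
  altSum≈fromℤ-K {n} {zero} tl hd [] z≤n with Vec.≡-dec ℕ._≟_ (replicate n 0) (replicate n 0)
  ... | yes _   = +-congʳ (*-identityˡ 1#)
  ... | no 0≢0 = contradiction ≡.refl 0≢0
  altSum≈fromℤ-K {m = suc m} tl hd L |L|≤1+m = begin
    altSum tl hd L                                                  ≈⟨ altSum-suc tl hd L ⟩
    - altSum tl′ hd′ (shift d L) + altSum tl′ hd′ L                 ≈⟨ -[x-y]≈-x+y _ _ ⟨
    - (altSum tl′ hd′ (shift d L) - altSum tl′ hd′ L)               ≈⟨ -‿cong (altSum-telescope tl′ hd′ d L) ⟩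
    - ∑ (telescope d L) (λ (j , L′) → d j * altSum tl′ hd′ L′)      ≈⟨ -‿cong (∑-cong-All (telescope d L) by-IH (telescope-deletions d L)) ⟩
    - ∑ (telescope d L) (λ (j , _) → d j * φ j)                     ≈⟨ -‿cong (∑-telescope-arcVec T H φ L) ⟩
    - (fromℕ (lookup t T) * φ T - fromℕ (lookup t H) * φ H)         ≈⟨ fromℤ-consArc T H (K tl′ hd′) t ⟨
    fromℤ (K tl hd t)                                               ∎
    where
    tl′ = tl ∘ Fin.suc
    hd′ = hd ∘ Fin.suc
    T = tl Fin.zero
    H = hd Fin.zero
    d = arcVec T H
    t = multiplicities L
    φ : Fin _ → Carrier
    φ j = fromℤ (K tl′ hd′ (dec j t))
    by-IH : ∀ q → IsDeletion L q → d (proj₁ q) * altSum tl′ hd′ (proj₂ q) ≈ d (proj₁ q) * φ (proj₁ q)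
    by-IH (j , L′) (len≡ , t≡) = *-congˡ (trans
      (altSum≈fromℤ-K tl′ hd′ L′ (ℕ.≤-pred (≡.subst (_≤ suc m) (≡.sym len≡) |L|≤1+m)))
      (reflexive (≡.cong (fromℤ ∘ K tl′ hd′) (≡.sym (≡.trans (≡.cong (dec j) t≡) (dec-inc j (multiplicities L′)))))))

  linProd-++ : (L₁ L₂ : List (Factor n)) (y : Fin n → Carrier) → linProd (L₁ ++ L₂) y ≈ linProd L₁ y * linProd L₂ y
  linProd-++ []             L₂ y = sym (*-identityˡ _)
  linProd-++ ((i , w) ∷ L₁) L₂ y = trans (*-congˡ (linProd-++ L₁ L₂ y)) (sym (*-assoc _ _ _))

  prodFin-cong : ∀ {k} {g h : Fin k → Carrier} → (∀ i → g i ≈ h i) → prodFin g ≈ prodFin h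
  prodFin-cong {zero}  g≈h = refl
  prodFin-cong {suc k} g≈h = *-cong (g≈h Fin.zero) (prodFin-cong (g≈h ∘ Fin.suc))

  prodFin≈linProd : ∀ {k} (i : Fin n) (w : Fin k → Carrier) (y : Fin n → Carrier) →
                    prodFin (λ j → y i - w j) ≈ linProd (List.tabulate (λ j → (i , w j))) y
  prodFin≈linProd {k = zero}  i w y = refl
  prodFin≈linProd {k = suc k} i w y = *-congˡ (prodFin≈linProd i (w ∘ Fin.suc) y)

  prodFin-linProd≈linProd-concat : ∀ {k} (M : Fin k → List (Factor n)) (y : Fin n → Carrier) →
                                   prodFin (λ i → linProd (M i) y) ≈ linProd (List.concat (List.tabulate M)) y
  prodFin-linProd≈linProd-concat {k = zero}  M y = refl
  prodFin-linProd≈linProd-concat {k = suc k} M y =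
    trans (*-congˡ (prodFin-linProd≈linProd-concat (M ∘ Fin.suc) y)) (sym (linProd-++ (M Fin.zero) _ y))

  ATSum≈altSum : ∀ {m} (G : Graph n m) (D : Orientation G) (u : (i : Fin n) → Fin (outdeg G D i) → Carrier) →
                 ATSum G D u ≈ altSum (tail G D) (head G D) (flatten (outdeg G D) u)
  ATSum≈altSum {m = m} G D u = ∑-cong (allSubsets m) λ A → *-congˡ (trans
    (prodFin-cong (λ i → prodFin≈linProd i (u i) (netOutdeg (tail G D) (head G D) A)))
    (prodFin-linProd≈linProd-concat (λ i → List.tabulate (λ j → (i , u i j))) (netOutdeg (tail G D) (head G D) A)))

  ATSum≈fromℤ-K : ∀ {m} (G : Graph n m) (D : Orientation G) (u : (i : Fin n) → Fin (outdeg G D i) → Carrier) →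
                  ATSum G D u ≈ fromℤ (K (tail G D) (head G D) (tabulate (outdeg G D)))
  ATSum≈fromℤ-K G D u = begin
    ATSum G D u                                    ≈⟨ ATSum≈altSum G D u ⟩
    altSum (tail G D) (head G D) L                 ≈⟨ altSum≈fromℤ-K (tail G D) (head G D) L (ℕ.≤-reflexive |L|≡m) ⟩
    fromℤ (K (tail G D) (head G D) (multiplicities L)) ≈⟨ reflexive (≡.cong (fromℤ ∘ K (tail G D) (head G D)) mult≡outdeg) ⟩
    fromℤ (K (tail G D) (head G D) (tabulate (outdeg G D))) ∎
    where
    L = flatten (outdeg G D) u
    mult≡outdeg = multiplicities-flatten (outdeg G D) u
    |L|≡m = ≡.trans (length≡sum-multiplicities L) (≡.trans (≡.cong Vec.sum mult≡outdeg) (sum-countFin-isYes (tail G D)))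

open AlternatingSums

orientation-sameEnds : ∀ {n m} (G : Graph n m) (D : Orientation G) →
                       SameEnds (tail G D) (head G D) (proj₁ ∘ edge G) (proj₂ ∘ edge G)
orientation-sameEnds G D e with D e
... | true  = inj₁ (≡.refl , ≡.refl)
... | false = inj₂ (≡.refl , ≡.refl)

AT⇔coeff≢0 : ∀ {n m} (G : Graph n m) (f : Fin n → ℕ) → Vec.sum (tabulate f) ≡ m →
             AT G (suc ∘ f) ⇔ (coeff (graphPoly G) (tabulate f) ≢ ℤ.0ℤ)
AT⇔coeff≢0 G f sum≡m = mk⇔ to from
  where
  a = proj₁ ∘ edge G
  b = proj₂ ∘ edge G
  to : AT G (suc ∘ f) → coeff (graphPoly G) (tabulate f) ≢ ℤ.0ℤ
  to (t , c≢0 , t≤f) = ≡.subst (λ v → coeff (graphPoly G) v ≢ ℤ.0ℤ) t≡f c≢0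
    where
    K≢0 : K a b t ≢ ℤ.0ℤ
    K≢0 = c≢0 ∘ Equivalence.to (K≡0⇔coeff≡0 a b t)
    t≡f : t ≡ tabulate f
    t≡f = pointwise-≤∧sum-≡⇒≡ t (tabulate f)
            (λ i → ≡.subst (lookup t i ≤_) (≡.sym (Vec.lookup∘tabulate f i)) (t≤f i))
            (≡.trans (K-homogeneous a b t K≢0) (≡.sym sum≡m))
  from : coeff (graphPoly G) (tabulate f) ≢ ℤ.0ℤ → AT G (suc ∘ f)
  from c≢0 = tabulate f , c≢0 , λ i → ℕ.≤-reflexive (Vec.lookup∘tabulate f i)

theorem1p5 : ∀ {c ℓ} (R : CommutativeRing c ℓ) → RingOps.CharZero R →
    ∀ {n m} (G : Graph n m) (D : Orientation G) →
    (u : (i : Fin n) → Fin (outdeg G D i) → CommutativeRing.Carrier R) →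
    AT G (λ i → suc (outdeg G D i)) ⇔
      (¬ (CommutativeRing._≈_ R (RingOps.ATSum R G D u) (CommutativeRing.0# R)))
theorem1p5 R char0 G D u = begin
  AT G (suc ∘ outdeg G D)                       ∼⟨ AT⇔coeff≢0 G (outdeg G D) (sum-countFin-isYes (tail G D)) ⟩
  (coeff (graphPoly G) d ≢ ℤ.0ℤ)                ∼⟨ ¬-cong-⇔ (⇔-sym (K≡0⇔coeff≡0 a b d)) ⟩
  (K a b d ≢ ℤ.0ℤ)                              ∼⟨ ¬-cong-⇔ (⇔-sym (K≡0-reorient (tail G D) (head G D) a b (orientation-sameEnds G D) d)) ⟩
  (K (tail G D) (head G D) d ≢ ℤ.0ℤ)            ∼⟨ ¬-cong-⇔ (⇔-sym (fromℤ≈0⇔≡0 R char0 _)) ⟩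
  (¬ fromℤ R (K (tail G D) (head G D) d) ≈ 0#)  ∼⟨ ¬-cong-⇔ (mk⇔ (trans ATSum≈) (trans (sym ATSum≈))) ⟩
  (¬ RingOps.ATSum R G D u ≈ 0#)                ∎
  where
  open CommutativeRing R using (_≈_; 0#; trans; sym)
  open Related.EquationalReasoning
  a = proj₁ ∘ edge G
  b = proj₂ ∘ edge G
  d = tabulate (outdeg G D)
  ATSum≈ = ATSum≈fromℤ-K R G D u
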